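{- For every PAI-model $\mathcal M=\langle W,R,\langle T_w,\oplus_w\rangle_{w\in W},V,\{t_w\}_{w\in W}\rangle$ there is a PAI-model $\mathcal M'=\langle W,R,\langle T'_w,\oplus'_w\rangle_{w\in W},V,\{t'_w\}_{w\in W}\rangle$ (same $W,R,V$) in which every $t'_w$ is surjective onto $T'_w$, and such that for all $w\in W$ and all formulas $\phi$: $\mathcal M,w\Vdash\phi$ iff $\mathcal M',w\Vdash\phi$.
   Context: Formulas are built from a countable set $Var$ of variables using $\neg$, $\lor$, $\Box$, $\to$; $\phi\supset\psi:=\neg\phi\lor\psi$. A PAI-model is a tuple $\langle W,R,\langle T_w,\oplus_w\rangle_{w\in W},V,\{t_w\}_{w\in W}\rangle$ where $R$ is a reflexive transitive relation on $W$; each $\langle T_w,\oplus_w\rangle$ is a join-semilattice with induced order $\leq_w$; each $t_w$ maps formulas to $T_w$ with $t_w(\neg\phi)=t_w(\Box\phi)=t_w(\phi)$ and $t_w(\phi\circ\psi)=t_w(\phi)\oplus_w t_w(\psi)$ for $\circ\in\{\lor,\to\}$; for $p,q\in Var$ and $w'\in R[w]$, $t_w(p)\leq_w t_w(q)$ implies $t_{w'}(p)\leq_{w'}t_{w'}(q)$; and $V:Var\to\mathscr P(W)$. Forcing: $w\Vdash p$ iff $w\in V(p)$; $\neg,\lor$ classical; $w\Vdash\Box\phi$ iff $w'\Vdash\phi$ for all $w'\in R[w]$; $w\Vdash\phi\to\psi$ iff $t_w(\psi)\leq_w t_w(\phi)$ and $w'\Vdash\phi\supset\psi$ for all $w'\in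 R[w]$. -}

module Defs where

open import Level using (Level; suc)
open import Data.Nat using (ℕ)
open import Data.Sum using (_⊎_)
open import Data.Product using (_×_)
open import Relation.Nullary using (¬_)
open import Relation.Binary.Definitions using (Reflexive; Transitive)
open import Algebra.Lattice.Bundles using (JoinSemilattice)

Var : Set
Var = ℕ

-- Formulas built with ¬, ∨, □, → (the strict/PAI implication)
data Formula : Set where
  var  : Var → Formula
  ¬'_  : Formula → Formula
  _∨'_ : Formula → Formula → Formula
  □_   : Formula → Formula
  _⇒_  : Formula → Formula → Formula

_⊃_ : Formula → Formula → Formula
φ ⊃ ψ = (¬' φ) ∨' ψ

record Frame (a : Level) : Set (suc a) where
  field
    W     : Set a
    R     : W → W → Set a
    R-refl  : Reflexive R
    R-trans : Transitive R
    V     : Var → W → Set a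

record PAIModel {a : Level} (F : Frame a) : Set (suc a) where
  open Frame F
  field
    T : W → JoinSemilattice a a
  Tc : W → Set a
  Tc w = JoinSemilattice.Carrier (T w)
  Le : (w : W) → Tc w → Tc w → Set a
  Le w x y = JoinSemilattice._≈_ (T w) (JoinSemilattice._∨_ (T w) x y) y
  field
    t : (w : W) → Formula → Tc w
    t-neg : ∀ w φ → JoinSemilattice._≈_ (T w) (t w (¬' φ)) (t w φ)
    t-box : ∀ w φ → JoinSemilattice._≈_ (T w) (t w (□ φ)) (t w φ)
    t-or  : ∀ w φ ψ → JoinSemilattice._≈_ (T w) (t w (φ ∨' ψ))
                        (JoinSemilattice._∨_ (T w) (t w φ) (t w ψ))
    t-imp : ∀ w φ ψ → JoinSemilattice._≈_ (T w) (t w (φ ⇒ ψ))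
                        (JoinSemilattice._∨_ (T w) (t w φ) (t w ψ))
    t-mono : ∀ (p q : Var) w w' → R w w' →
             Le w (t w (var p)) (t w (var q)) →
             Le w' (t w' (var p)) (t w' (var q))

module _ {a : Level} {F : Frame a} (M : PAIModel F) where
  open Frame F
  open PAIModel M

  _⊩_ : W → Formula → Set a
  w ⊩ var p   = V p w
  w ⊩ (¬' φ)  = ¬ (w ⊩ φ)
  w ⊩ (φ ∨' ψ) = (w ⊩ φ) ⊎ (w ⊩ ψ)
  w ⊩ (□ φ)   = ∀ w' → R w w' → w' ⊩ φ
  w ⊩ (φ ⇒ ψ) = Le w (t w ψ) (t w φ) × (∀ w' → R w w' → (¬ (w' ⊩ φ) ⊎ (w' ⊩ ψ)))
  -- (the last component is literally  w' ⊩ (φ ⊃ ψ), unfolded for termination)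

{-# OPTIONS --safe #-}
module Submission where

-- Replace each T_w by the image of t_w. The image is closed under ⊕_w, because
-- t_w(φ) ⊕_w t_w(ψ) = t_w(φ ∨ ψ), so it is a sub-semilattice onto which t_w is
-- surjective. Its order is the restriction of ≤_w, and forcing sees the
-- semilattices only through the order between values of t_w, so no formula
-- changes its truth value.

open import Defs
open import Level using (_⊔_)
open import Data.Product using (Σ; ∃; _×_; _,_; proj₁)
open import Data.Product.Function.NonDependent.Propositional using (_×-⇔_)
open import Data.Sum.Function.Propositional using (_⊎-⇔_)
open import Function using (_on_)
open import Function.Bundles using (_⇔_; mk⇔; module Equivalence)
open import Function.Definitions using (Surjective)
open import Function.Construct.Identity using (⇔-id)
open import Function.Related.TypeIsomorphisms using (¬-cong-⇔)
open import Relation.Binary.PropositionalEquality using (_≡_; refl)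
import Relation.Binary.Construct.On as On
open import Algebra.Lattice.Bundles using (JoinSemilattice)

Π-⇔ : ∀ {a b c} {A : Set a} {B : A → Set b} {C : A → Set c} →
      (∀ x → B x ⇔ C x) → (∀ x → B x) ⇔ (∀ x → C x)
Π-⇔ B⇔C = mk⇔ (λ f x → Equivalence.to (B⇔C x) (f x))
              (λ g x → Equivalence.from (B⇔C x) (g x))

module ImageSemilattice {c ℓ a} (L : JoinSemilattice c ℓ) {A : Set a}
  (f : A → JoinSemilattice.Carrier L) (_⊙_ : A → A → A)
  (f-homo : ∀ x y → JoinSemilattice._≈_ L (f (x ⊙ y))
                      (JoinSemilattice._∨_ L (f x) (f y)))
  where
  open JoinSemilattice L renaming (refl to ≈-refl)

  Image : Set (c ⊔ ℓ ⊔ a)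
  Image = Σ Carrier λ y → ∃ λ x → f x ≈ y

  _∨ᵢ_ : Image → Image → Image
  (y , x , fx≈y) ∨ᵢ (y′ , x′ , fx′≈y′) =
    y ∨ y′ , x ⊙ x′ , trans (f-homo x x′) (∨-cong fx≈y fx′≈y′)

  imageJoinSemilattice : JoinSemilattice (c ⊔ ℓ ⊔ a) ℓ
  imageJoinSemilattice = record
    { Carrier = Image
    ; _≈_ = _≈_ on proj₁
    ; _∨_ = _∨ᵢ_
    ; isJoinSemilattice = record
      { isBand = record
        { isSemigroup = record
          { isMagma = record
            { isEquivalence = On.isEquivalence proj₁ isEquivalence
            ; ∙-cong = ∨-cong
            }
          ; assoc = λ x y z → assoc (proj₁ x) (proj₁ y) (proj₁ z)
          }
        ; idem = λ x → idem (proj₁ x)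
        }
      ; comm = λ x y → comm (proj₁ x) (proj₁ y)
      }
    }

  corestrict : A → Image
  corestrict x = f x , x , ≈-refl

  corestrict-surjective : Surjective _≡_ (_≈_ on proj₁) corestrict
  corestrict-surjective (y , x , fx≈y) = x , λ { refl → fx≈y }

module _ {a} {F : Frame a} where
  open PAIModel using (t; Le)

  SameInducedOrder : PAIModel F → PAIModel F → Set a
  SameInducedOrder M N =
    ∀ w φ ψ → Le M w (t M w φ) (t M w ψ) ⇔ Le N w (t N w φ) (t N w ψ)

  ⊩-⇔-sameInducedOrder : ∀ {M N} → SameInducedOrder M N →
                          ∀ w φ → _⊩_ M w φ ⇔ _⊩_ N w φ
  ⊩-⇔-sameInducedOrder _    _ (var _)  = ⇔-id _
  ⊩-⇔-sameInducedOrder same w (¬' φ)   = ¬-cong-⇔ (⊩-⇔-sameInducedOrder same w φ)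
  ⊩-⇔-sameInducedOrder same w (φ ∨' ψ) =
    ⊩-⇔-sameInducedOrder same w φ ⊎-⇔ ⊩-⇔-sameInducedOrder same w ψ
  ⊩-⇔-sameInducedOrder same w (□ φ)    =
    Π-⇔ λ w′ → Π-⇔ λ _ → ⊩-⇔-sameInducedOrder same w′ φ
  ⊩-⇔-sameInducedOrder same w (φ ⇒ ψ)  =
    same w ψ φ ×-⇔ Π-⇔ λ w′ → Π-⇔ λ _ →
      ¬-cong-⇔ (⊩-⇔-sameInducedOrder same w′ φ) ⊎-⇔ ⊩-⇔-sameInducedOrder same w′ ψ

module _ {a} {F : Frame a} (M : PAIModel F) where
  open PAIModel M
  module Imageₜ w = ImageSemilattice (T w) (t w) _∨'_ (t-or w)

  imageModel : PAIModel F
  imageModel = record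
    { T = λ w → Imageₜ.imageJoinSemilattice w
    ; t = λ w → Imageₜ.corestrict w
    ; t-neg = t-neg
    ; t-box = t-box
    ; t-or = t-or
    ; t-imp = t-imp
    ; t-mono = t-mono
    }

  imageModel-sameInducedOrder : SameInducedOrder M imageModel
  imageModel-sameInducedOrder _ _ _ = ⇔-id _

mainTheorem7 : ∀ {a} (F : Frame a) (M : PAIModel F) →
    Σ (PAIModel F) λ M' →
      (∀ w → Surjective _≡_ (JoinSemilattice._≈_ (PAIModel.T M' w)) (PAIModel.t M' w))
      × (∀ w φ → (_⊩_ M w φ) ⇔ (_⊩_ M' w φ))
mainTheorem7 F M =
  imageModel M ,
  Imageₜ.corestrict-surjective M ,
  ⊩-⇔-sameInducedOrder (imageModel-sameInducedOrder M)
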